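{- Let $F$ be a function from the class of all finite graphs to an abelian group such that $F(\Gamma)=F(\Gamma\setminus e)-F(\Gamma/e)$ for every graph $\Gamma$ and every link $e$ of $\Gamma$. Then $F$ has loop nullity if and only if $F$ is invariant under simplification. Moreover, let $\Gamma_0$ be any graph and let $F$ be a function from $\mathcal{M}(\Gamma_0)$ to an abelian group such that $F(\Gamma)=F(\Gamma\setminus e)-F(\Gamma/e)$ for every $\Gamma\in\mathcal{M}(\Gamma_0)$ and every link $e$ of $\Gamma$. If $F$ has loop nullity, then $F$ is invariant under simplification (on $\mathcal{M}(\Gamma_0)$).
   Context: Graphs are finite and may have loops and multiple edges. A link is an edge with two distinct endpoints; a loop has coinciding endpoints. $\Gamma\setminus e$ is deletion of $e$; $\Gamma/e$ (for a link $e$) identifies the two endpoints of $e$ and deletes $e$ (other edges are kept, so edges parallel to $e$ become loops). Edges with the same endpoints are parallel. The simplification of a graph is obtained by removing all but one edge of each set of parallel edges, including parallel loops (loops are not removed altogether). $F$ has loop nullity if $F(\Gamma)=0$ whenever $\Gamma$ has a loop; $F$ is invariant under simplification if $F(\Gamma')=F(\Gamma)$ whenever $\Gamma'$ is obtained from $\Gamma$ by simplification. $\mathcal{M}(\Gamma_0)$ is the set of edge minors of $\Gamma_0$, i.e., graphs obtained from $\Gamma_0$ by any sequence of deletions and contractions of edges (including $\Gamma_0$ itself). -}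

module Defs where

open import Level using (Level; _⊔_)
open import Data.Nat using (ℕ; zero; suc)
open import Data.Fin using (Fin; zero; suc; punchOut; _≟_)
open import Data.Product using (_×_; _,_; proj₁; proj₂; swap)
open import Data.Sum using (_⊎_)
open import Data.Unit using (⊤)
open import Data.List using (List; length; lookup; removeAt; map)
open import Data.List.Relation.Unary.Any using (Any)
open import Data.List.Relation.Unary.All using (All)
open import Data.List.Relation.Unary.AllPairs using (AllPairs)
open import Data.List.Relation.Binary.Sublist.Propositional using (_⊆_)
open import Relation.Nullary using (¬_; yes; no)
open import Relation.Binary.PropositionalEquality using (_≡_; _≢_; sym)
open import Function using (_∘_)
open import Algebra.Bundles using (AbelianGroup)

-- Vertices are Fin V; edges are an (ordered, labelled by position) list
-- of endpoint pairs.  An edge (u , v) is undirected: (u , v) and (v , u)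
-- have the same endpoints.

record Graph : Set where
  constructor mkGraph
  field
    V : ℕ
    E : List (Fin V × Fin V)
open Graph public

Edge : Graph → Set
Edge Γ = Fin (length (E Γ))

ends : (Γ : Graph) → Edge Γ → Fin (V Γ) × Fin (V Γ)
ends Γ k = lookup (E Γ) k

IsLink : (Γ : Graph) → Edge Γ → Set
IsLink Γ k = proj₁ (ends Γ k) ≢ proj₂ (ends Γ k)

IsLoopPair : ∀ {n} → Fin n × Fin n → Set
IsLoopPair (u , v) = u ≡ v

HasLoop : Graph → Set
HasLoop Γ = Any IsLoopPair (E Γ)

delete : (Γ : Graph) → Edge Γ → Graph
delete Γ k = mkGraph (V Γ) (removeAt (E Γ) k)

-- contraction: vertex v is identified with vertex u (u ≢ v); the
-- remaining vertices are renumbered by punching out v.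
merge : ∀ {m} (u v : Fin (suc m)) → u ≢ v → Fin (suc m) → Fin m
merge u v u≢v x with x ≟ v
... | yes _   = punchOut {i = v} {j = u} (u≢v ∘ sym)
... | no x≢v  = punchOut {i = v} {j = x} (x≢v ∘ sym)

contractAux : ∀ n (u v : Fin n) → u ≢ v → List (Fin n × Fin n) → Graph
contractAux zero    () v u≢v es
contractAux (suc m) u  v u≢v es =
  mkGraph m (map (λ p → merge u v u≢v (proj₁ p) , merge u v u≢v (proj₂ p)) es)

-- contraction Γ / e of a link e: identify the endpoints of e and delete e
-- (all other edges are kept, so edges parallel to e become loops)
contract : (Γ : Graph) (k : Edge Γ) → IsLink Γ k → Graph
contract Γ k l =
  contractAux (V Γ) (proj₁ (ends Γ k)) (proj₂ (ends Γ k)) l (removeAt (E Γ) k)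

Parallel : ∀ {n} → Fin n × Fin n → Fin n × Fin n → Set
Parallel p q = (p ≡ q) ⊎ (p ≡ swap q)

data IsSimplificationOf : Graph → Graph → Set where
  simp : ∀ {n} {es es' : List (Fin n × Fin n)} →
         es' ⊆ es →
         All (λ e → Any (Parallel e) es') es →
         AllPairs (λ a b → ¬ Parallel a b) es' →
         IsSimplificationOf (mkGraph n es') (mkGraph n es)

data Minor (Γ₀ : Graph) : Graph → Set where
  here : Minor Γ₀ Γ₀
  del  : ∀ {Γ} → Minor Γ₀ Γ → (k : Edge Γ) → Minor Γ₀ (delete Γ k)
  con  : ∀ {Γ} → Minor Γ₀ Γ → (k : Edge Γ) (l : IsLink Γ k) →
         Minor Γ₀ (contract Γ k l)

module _ {c ℓ p} (G : AbelianGroup c ℓ) (P : Graph → Set p) where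
  open AbelianGroup G

  DeletionContractionOn : (Graph → Carrier) → Set (ℓ ⊔ p)
  DeletionContractionOn F = ∀ Γ → P Γ → (k : Edge Γ) (l : IsLink Γ k) →
    F Γ ≈ F (delete Γ k) ∙ (F (contract Γ k l) ⁻¹)

  LoopNullityOn : (Graph → Carrier) → Set (ℓ ⊔ p)
  LoopNullityOn F = ∀ Γ → P Γ → HasLoop Γ → F Γ ≈ ε

  SimplificationInvariantOn : (Graph → Carrier) → Set (ℓ ⊔ p)
  SimplificationInvariantOn F = ∀ Γ Γ' → P Γ → IsSimplificationOf Γ' Γ →
    F Γ' ≈ F Γ

AllGraphs : Graph → Set
AllGraphs _ = ⊤

-- Loop nullity ⇒ invariance: delete the surplus parallel edges one at a time.  A surplus
-- loop is harmless because the graph has a loop both before and after; for a surplus link e,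
-- F(Γ) = F(Γ \ e) - F(Γ / e) and Γ / e has a loop (the edge that was parallel to e).
--
-- Invariance ⇒ loop nullity: given a loop at x in Γ, add a pendant vertex w, a link e = xw and
-- turn every loop at x into a further xw-edge.  The resulting graph H has a parallel copy of e,
-- so H and H \ e have the same simplification, while H / e = Γ.  Deletion–contraction gives
-- F(H) = F(H) - F(Γ), hence F(Γ) = 0.
module Submission where

open import Defs
open import Data.Product using (_×_)
open import Function.Bundles using (_⇔_)
open import Algebra.Bundles using (AbelianGroup)

open import Data.Nat using (ℕ; suc)
open import Data.Fin as Fin using (Fin; zero; suc; punchOut; fromℕ; inject₁)
open import Data.Fin.Properties using (punchOut-cong; fromℕ≢inject₁)
open import Data.Product using (_,_; proj₁; proj₂; swap; ∃-syntax)
import Data.Product as Product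
open import Data.Product.Properties using (≡-dec)
open import Data.Sum using (inj₁; inj₂)
open import Data.Unit using (tt)
open import Data.List using (List; []; _∷_; _++_; [_]; length; lookup; removeAt; map)
open import Data.List.Properties using (++-assoc; map-∘; map-id; map-cong)
open import Data.List.Relation.Unary.Any as Any using (Any; here; there; any?)
open import Data.List.Relation.Unary.Any.Properties using (map⁺)
open import Data.List.Relation.Unary.All as All using (All; []; _∷_)
open import Data.List.Relation.Unary.All.Properties using (¬Any⇒All¬)
open import Data.List.Relation.Unary.AllPairs using ([]; _∷_)
open import Data.List.Relation.Binary.Sublist.Propositional using (_⊆_; []; _∷_; _∷ʳ_; ⊆-refl)
open import Data.List.Relation.Binary.Sublist.Propositional.Properties using (Any-resp-⊆; ++⁺)
open import Data.List.Membership.Propositional using (_∈_; find; lose)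
open import Data.List.Membership.Propositional.Properties using (∈-lookup; ∈-map⁺)
open import Relation.Nullary using (yes; no; Dec; contradiction)
open import Relation.Binary.PropositionalEquality
  using (_≡_; _≢_; refl; sym; cong; cong₂; subst; subst₂; module ≡-Reasoning)
open import Function using (_∘_; id; mk⇔)
import Algebra.Properties.Group as GroupProperties

Ends : ℕ → Set
Ends n = Fin n × Fin n

parallel? : ∀ {n} (p q : Ends n) → Dec (Parallel p q)
parallel? p q with ≡-dec Fin._≟_ Fin._≟_ p q | ≡-dec Fin._≟_ Fin._≟_ p (swap q)
... | yes p≡q | _        = yes (inj₁ p≡q)
... | no _    | yes p≡q˘ = yes (inj₂ p≡q˘)
... | no p≢q  | no p≢q˘  = no λ { (inj₁ p≡q) → p≢q p≡q ; (inj₂ p≡q˘) → p≢q˘ p≡q˘ }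

IsLoopPair-resp-Parallel : ∀ {n} {p q : Ends n} → IsLoopPair p → Parallel p q → IsLoopPair q
IsLoopPair-resp-Parallel refl (inj₁ refl) = refl
IsLoopPair-resp-Parallel refl (inj₂ refl) = refl

simplification : ∀ {n} (es : List (Ends n)) →
  ∃[ es' ] IsSimplificationOf (mkGraph n es') (mkGraph n es)
simplification [] = [] , simp [] [] []
simplification (e ∷ es) with simplification es
... | es' , simp sub covers distinct with any? (parallel? e) es'
...   | yes e∥ = es' , simp (e ∷ʳ sub) (e∥ ∷ covers) distinct
...   | no ¬e∥ = e ∷ es' , simp (refl ∷ sub) (here (inj₁ refl) ∷ All.map there covers)
                                (¬Any⇒All¬ es' ¬e∥ ∷ distinct)

IsSimplificationOf-∷⁺ : ∀ {n} {e} {es : List (Ends n)} {Γ'} → e ∈ es →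
  IsSimplificationOf Γ' (mkGraph n es) → IsSimplificationOf Γ' (mkGraph n (e ∷ es))
IsSimplificationOf-∷⁺ e∈es (simp sub covers distinct) =
  simp (_ ∷ʳ sub) (All.lookup covers e∈es ∷ covers) distinct

merge-identifies : ∀ {m} (u v : Fin (suc m)) (u≢v : u ≢ v) → merge u v u≢v u ≡ merge u v u≢v v
merge-identifies u v u≢v with u Fin.≟ v | v Fin.≟ v
... | yes u≡v | _       = contradiction u≡v u≢v
... | no _    | no v≢v  = contradiction refl v≢v
... | no _    | yes _   = punchOut-cong v refl

contractAux-loop : ∀ n (u v : Fin n) (u≢v : u ≢ v) (es : List (Ends n)) →
  Any (Parallel (u , v)) es → HasLoop (contractAux n u v u≢v es)
contractAux-loop (suc m) u v u≢v es e∥ = map⁺ (Any.map merged-loop e∥)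
  where
  merged-loop : ∀ {p} → Parallel (u , v) p → merge u v u≢v (proj₁ p) ≡ merge u v u≢v (proj₂ p)
  merged-loop (inj₁ refl) = merge-identifies u v u≢v
  merged-loop (inj₂ refl) = sym (merge-identifies u v u≢v)

contract-loop : ∀ Γ k (l : IsLink Γ k) →
  Any (Parallel (ends Γ k)) (E (delete Γ k)) → HasLoop (contract Γ k l)
contract-loop Γ k l = contractAux-loop (V Γ) _ _ l (removeAt (E Γ) k)

punchOut-fromℕ-inject₁ : ∀ {n} (a : Fin n) (p : fromℕ n ≢ inject₁ a) → punchOut p ≡ a
punchOut-fromℕ-inject₁ {suc n} zero    p = refl
punchOut-fromℕ-inject₁ {suc n} (suc a) p = cong suc (punchOut-fromℕ-inject₁ a (p ∘ cong suc))

module _ {n : ℕ} (x : Fin n) where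

  mergeLast : Fin (suc n) → Fin n
  mergeLast = merge (inject₁ x) (fromℕ n) (fromℕ≢inject₁ ∘ sym)

  mergeLast-inject₁ : ∀ a → mergeLast (inject₁ a) ≡ a
  mergeLast-inject₁ a with inject₁ a Fin.≟ fromℕ n
  ... | yes a≡last = contradiction (sym a≡last) fromℕ≢inject₁
  ... | no _       = punchOut-fromℕ-inject₁ a _

  mergeLast-fromℕ : mergeLast (fromℕ n) ≡ x
  mergeLast-fromℕ with fromℕ n Fin.≟ fromℕ n
  ... | yes _       = punchOut-fromℕ-inject₁ x _
  ... | no last≢last = contradiction refl last≢last

  openLoop : Ends n → Ends (suc n)
  openLoop p with ≡-dec Fin._≟_ Fin._≟_ p (x , x)
  ... | yes _ = inject₁ x , fromℕ n
  ... | no _  = Product.map inject₁ inject₁ p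

  mergeLast-openLoop : ∀ p → Product.map mergeLast mergeLast (openLoop p) ≡ p
  mergeLast-openLoop p with ≡-dec Fin._≟_ Fin._≟_ p (x , x)
  ... | yes refl = cong₂ _,_ (mergeLast-inject₁ x) mergeLast-fromℕ
  ... | no _     = cong₂ _,_ (mergeLast-inject₁ (proj₁ p)) (mergeLast-inject₁ (proj₂ p))

  openLoop-loop : openLoop (x , x) ≡ (inject₁ x , fromℕ n)
  openLoop-loop with ≡-dec Fin._≟_ Fin._≟_ (x , x) (x , x)
  ... | yes _  = refl
  ... | no x≢x = contradiction refl x≢x

  loopOpened : List (Ends n) → Graph
  loopOpened es = mkGraph (suc n) ((inject₁ x , fromℕ n) ∷ map openLoop es)

  loopOpened-link : ∀ es → IsLink (loopOpened es) zero
  loopOpened-link es = fromℕ≢inject₁ ∘ sym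

  contract-loopOpened : ∀ es → contract (loopOpened es) zero (loopOpened-link es) ≡ mkGraph n es
  contract-loopOpened es = cong (mkGraph n) (begin
    map (Product.map mergeLast mergeLast) (map openLoop es) ≡⟨ map-∘ es ⟨
    map (Product.map mergeLast mergeLast ∘ openLoop) es    ≡⟨ map-cong mergeLast-openLoop es ⟩
    map id es                                              ≡⟨ map-id es ⟩
    es                                                     ∎)
    where open ≡-Reasoning

indexAfter : ∀ {A : Set} (pre : List A) (y : A) (ys : List A) → Fin (length (pre ++ y ∷ ys))
indexAfter []        y ys = zero
indexAfter (x ∷ pre) y ys = suc (indexAfter pre y ys)

removeAt-indexAfter : ∀ {A : Set} (pre : List A) y ys →
  removeAt (pre ++ y ∷ ys) (indexAfter pre y ys) ≡ pre ++ ys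
removeAt-indexAfter []        y ys = refl
removeAt-indexAfter (x ∷ pre) y ys = cong (x ∷_) (removeAt-indexAfter pre y ys)

lookup-indexAfter : ∀ {A : Set} (pre : List A) y ys → lookup (pre ++ y ∷ ys) (indexAfter pre y ys) ≡ y
lookup-indexAfter []        y ys = refl
lookup-indexAfter (x ∷ pre) y ys = lookup-indexAfter pre y ys

delete-indexAfter : ∀ {n} (pre : List (Ends n)) y ys →
  delete (mkGraph n (pre ++ y ∷ ys)) (indexAfter pre y ys) ≡ mkGraph n (pre ++ ys)
delete-indexAfter {n} pre y ys = cong (mkGraph n) (removeAt-indexAfter pre y ys)

record MinorClosed {p} (P : Graph → Set p) : Set p where
  field
    delete-closed   : ∀ {Γ} → P Γ → (k : Edge Γ) → P (delete Γ k)
    contract-closed : ∀ {Γ} → P Γ → (k : Edge Γ) (l : IsLink Γ k) → P (contract Γ k l)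

AllGraphs-minorClosed : MinorClosed AllGraphs
AllGraphs-minorClosed = record { delete-closed = λ _ _ → tt ; contract-closed = λ _ _ _ → tt }

Minor-minorClosed : ∀ Γ₀ → MinorClosed (Minor Γ₀)
Minor-minorClosed Γ₀ = record { delete-closed = del ; contract-closed = con }

module _ {c ℓ} (G : AbelianGroup c ℓ) where
  open AbelianGroup G renaming (refl to ≈-refl; sym to ≈-sym; trans to ≈-trans)
  open GroupProperties group using (ε⁻¹≈ε; ⁻¹-injective; identityʳ-unique)
  open import Relation.Binary.Reasoning.Setoid setoid

  ∙⁻¹-identityʳ : ∀ {x y} → y ≈ ε → x ∙ y ⁻¹ ≈ x
  ∙⁻¹-identityʳ {x} {y} y≈ε = begin
    x ∙ y ⁻¹ ≈⟨ ∙-congˡ (⁻¹-cong y≈ε) ⟩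
    x ∙ ε ⁻¹ ≈⟨ ∙-congˡ ε⁻¹≈ε ⟩
    x ∙ ε    ≈⟨ identityʳ x ⟩
    x        ∎

  ≈∙⁻¹-identityʳ : ∀ {x y} → x ≈ x ∙ y ⁻¹ → y ≈ ε
  ≈∙⁻¹-identityʳ {x} {y} x≈x∙y⁻¹ =
    ⁻¹-injective (≈-trans (identityʳ-unique x (y ⁻¹) (≈-sym x≈x∙y⁻¹)) (≈-sym ε⁻¹≈ε))

  module _ {p} {P : Graph → Set p} (closed : MinorClosed P) {F : Graph → Carrier}
           (dc : DeletionContractionOn G P F) (ln : LoopNullityOn G P F) where
    open MinorClosed closed

    delete-redundant : ∀ {Γ} → P Γ → (k : Edge Γ) →
      Any (Parallel (ends Γ k)) (E (delete Γ k)) → F (delete Γ k) ≈ F Γ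
    delete-redundant {Γ} PΓ k e∥ with proj₁ (ends Γ k) Fin.≟ proj₂ (ends Γ k)
    ... | yes loop = ≈-trans (ln _ (delete-closed PΓ k) (Any.map (IsLoopPair-resp-Parallel loop) e∥))
                             (≈-sym (ln Γ PΓ (lose (∈-lookup k) loop)))
    ... | no link  = ≈-sym (≈-trans (dc Γ PΓ k link)
      (∙⁻¹-identityʳ (ln _ (contract-closed PΓ k link) (contract-loop Γ k link e∥))))

    delete-redundant-after : ∀ {n} pre y (ys : List (Ends n)) → P (mkGraph n (pre ++ y ∷ ys)) →
      Any (Parallel y) (pre ++ ys) → F (mkGraph n (pre ++ ys)) ≈ F (mkGraph n (pre ++ y ∷ ys))
    delete-redundant-after {n} pre y ys PΓ y∥ =
      subst (λ Δ → F Δ ≈ F (mkGraph n (pre ++ y ∷ ys))) (delete-indexAfter pre y ys)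
        (delete-redundant PΓ (indexAfter pre y ys)
          (subst₂ (λ e es → Any (Parallel e) es)
            (sym (lookup-indexAfter pre y ys)) (sym (removeAt-indexAfter pre y ys)) y∥))

    -- the kept prefix pre is needed because deletion refers to positions in the whole edge list
    delete-covered : ∀ {n} (pre : List (Ends n)) {es' es} → es' ⊆ es →
      All (λ e → Any (Parallel e) (pre ++ es')) es → P (mkGraph n (pre ++ es)) →
      F (mkGraph n (pre ++ es')) ≈ F (mkGraph n (pre ++ es))
    delete-covered pre [] [] PΓ = ≈-refl
    delete-covered pre {es = y ∷ ys} (.y ∷ʳ sub) (y∥ ∷ covers) PΓ =
      ≈-trans (delete-covered pre sub covers (subst P (delete-indexAfter pre y ys)
                                                       (delete-closed PΓ (indexAfter pre y ys))))
              (delete-redundant-after pre y ys PΓ (Any-resp-⊆ (++⁺ ⊆-refl sub) y∥))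
    delete-covered {n} pre {x ∷ xs} {.x ∷ ys} (refl ∷ sub) (_ ∷ covers) PΓ =
      subst₂ (λ es' es → F (mkGraph n es') ≈ F (mkGraph n es))
        (++-assoc pre [ x ] xs) (++-assoc pre [ x ] ys)
        (delete-covered (pre ++ [ x ]) sub
          (All.map (subst (Any _) (sym (++-assoc pre [ x ] xs))) covers)
          (subst (P ∘ mkGraph n) (sym (++-assoc pre [ x ] ys)) PΓ))

    loopNullity⇒simplificationInvariant : SimplificationInvariantOn G P F
    loopNullity⇒simplificationInvariant _ _ PΓ (simp sub covers _) = delete-covered [] sub covers PΓ

  module _ {F : Graph → Carrier} (dc : DeletionContractionOn G AllGraphs F)
           (si : SimplificationInvariantOn G AllGraphs F) where

    contract-redundant-head : ∀ {n} {e} {es : List (Ends n)} (l : IsLink (mkGraph n (e ∷ es)) zero) →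
      e ∈ es → F (contract (mkGraph n (e ∷ es)) zero l) ≈ ε
    contract-redundant-head {n} {e} {es} l e∈es with simplification es
    ... | es' , es'-simplifies = ≈∙⁻¹-identityʳ (begin
      F (mkGraph n es)       ≈⟨ si _ _ tt es'-simplifies ⟨
      F (mkGraph n es')      ≈⟨ si _ _ tt (IsSimplificationOf-∷⁺ e∈es es'-simplifies) ⟩
      F (mkGraph n (e ∷ es)) ≈⟨ dc _ tt zero l ⟩
      F (mkGraph n es) ∙ F (contract (mkGraph n (e ∷ es)) zero l) ⁻¹ ∎)

    simplificationInvariant⇒loopNullity : LoopNullityOn G AllGraphs F
    simplificationInvariant⇒loopNullity (mkGraph n es) _ hasLoop with find hasLoop
    ... | (x , .x) , xx∈es , refl =
      subst (λ Γ → F Γ ≈ ε) (contract-loopOpened x es)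
        (contract-redundant-head (loopOpened-link x es)
          (subst (_∈ map (openLoop x) es) (openLoop-loop x) (∈-map⁺ (openLoop x) xx∈es)))

lemma3p1 : ∀ {c ℓ} (G : AbelianGroup c ℓ) →
    (∀ (F : Graph → AbelianGroup.Carrier G) →
    DeletionContractionOn G AllGraphs F →
    (LoopNullityOn G AllGraphs F ⇔ SimplificationInvariantOn G AllGraphs F))
    ×
    (∀ (Γ₀ : Graph) (F : Graph → AbelianGroup.Carrier G) →
    DeletionContractionOn G (Minor Γ₀) F →
    LoopNullityOn G (Minor Γ₀) F →
    SimplificationInvariantOn G (Minor Γ₀) F)
lemma3p1 G =
  (λ F dc → mk⇔ (loopNullity⇒simplificationInvariant G AllGraphs-minorClosed dc)
                (simplificationInvariant⇒loopNullity G dc))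
  , λ Γ₀ F → loopNullity⇒simplificationInvariant G (Minor-minorClosed Γ₀)
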